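{- Let $T$ be a tetrahedron in $PG(3,2)$. Let $G$ be a cubic graph with $\pi(G)\ge 5$ containing two $5$-cycles $C_1$ and $C_2$ such that $C_1\cap C_2$ is a path of length $2$. Let $e$ and $f$ be the two edges of $C_1\cup C_2$ that are not incident with any vertex of $C_1\cap C_2$. Let $X$ be the $(2,2)$-pole obtained from $G$ by severing $e$ and $f$, where one connector consists of the two dangling edges arising from $e$ and the other connector consists of the two dangling edges arising from $f$. Then every transition (of shapes) through $X$ is one of $$\mathtt{hl}\to\mathtt{hl},\quad \mathtt{ls}\to\mathtt{ls},\quad \mathtt{alt}\to\mathtt{alt},\quad \mathtt{ang}\to\mathtt{ls},\quad \mathtt{ls}\to\mathtt{ang}.$$
   Context: $\pi(G)$, the perfect matching index of a cubic graph $G$, is the smallest number of perfect matchings of $G$ whose union is $E(G)$ ($\pi(G)\ge 5$ includes the case that no such cover with four perfect matchings exists). A multipole is like a graph but may have dangling edges (edges with one end incident with a vertex and the other end free); all multipoles here are cubic (each vertex is incident with exactly three edge-ends). A $(2,2)$-pole is a multipole with four dangling edges partitioned into an input connector $I=\{g_1,g_2\}$ and an output connector $O=\{h_1,h_2\}$. Severing an edge $uv$ replaces it by two dangling edges, one attached to $u$ and one to $v$. $PG(3,2)$: points are the nonzero vectors of $\mathbb{F}_2^4$; lines are triples $\{x,y,z\}$ of points with $x+y+z=0$. A tetrahedron $T$ is determined by four points $p_1,p_2,p_3,p_4$ forming a basis of $\mathbb{F}_2^4$ (its corner points); its points are the four corner points and the six midpoints $c_1+c_2$ ($c_1\ne c_2$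 corner points); its lines are the six triples $\{c_1,c_2,c_1+c_2\}$. A $T$-flow on a cubic graph or multipole is a map $\phi$ from its edges (including dangling edges) to the points of $T$ such that at every vertex the values of the three incident edges form a line of $T$. Shapes of unordered pairs of points of $T$ (with $c_1,c_2,c_3,c_4$ denoting distinct corner points): line segment $\mathtt{ls}$: $\{c_1,c_2\}$; half-line $\mathtt{hl}$: $\{c_1,c_1+c_2\}$; angle $\mathtt{ang}$: $\{c_1+c_2,c_1+c_3\}$; altitude $\mathtt{alt}$: $\{c_1,c_2+c_3\}$; axis $\mathtt{ax}$: $\{c_1+c_2,c_3+c_4\}$; double point $\mathtt{dpt}$: $\{x,x\}$ for any point $x$ of $T$. Every pair has exactly one shape. A $(2,2)$-pole $X$ has a transition $\mathtt{s}\to\mathtt{t}$ if there is a $T$-flow $\phi$ on $X$ such that $\{\phi(g_1),\phi(g_2)\}$ has shape $\mathtt{s}$ and $\{\phi(h_1),\phi(h_2)\}$ has shape $\mathtt{t}$. -}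

module Defs where

open import Data.Nat using (ℕ; _≤_)
open import Data.Bool using (Bool; true; false; _xor_; if_then_else_; _∨_)
open import Data.Fin using (Fin; zero; suc)
open import Data.Fin.Properties renaming (_≟_ to _≟ᶠ_)
open import Data.Vec using (Vec; zipWith; replicate)
open import Data.List using (List; []; _∷_; length)
open import Data.List.Relation.Unary.All using (All)
open import Data.List.Relation.Unary.Any using (Any)
open import Data.List.Relation.Binary.Permutation.Propositional using (_↭_)
open import Data.Product using (Σ; ∃; ∃-syntax; _×_; _,_; proj₁; proj₂)
open import Data.Product.Properties using (≡-dec)
open import Data.Sum using (_⊎_)
open import Relation.Nullary using (¬_)
open import Relation.Nullary.Decidable using (⌊_⌋)
open import Relation.Binary.PropositionalEquality using (_≡_; _≢_)
open import Relation.Binary using (DecidableEquality)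

-- vectors of F₂⁴ (points of PG(3,2) are the nonzero ones)
V4 : Set
V4 = Vec Bool 4

_⊕_ : V4 → V4 → V4
_⊕_ = zipWith _xor_

𝟎 : V4
𝟎 = replicate 4 false

sel : Bool → V4 → V4
sel b v = if b then v else 𝟎

comb : (Fin 4 → Bool) → (Fin 4 → V4) → V4
comb s c = sel (s zero) (c zero) ⊕ (sel (s (suc zero)) (c (suc zero))
         ⊕ (sel (s (suc (suc zero))) (c (suc (suc zero)))
         ⊕ sel (s (suc (suc (suc zero)))) (c (suc (suc (suc zero))))))

record Tetrahedron : Set where
  field
    corner   : Fin 4 → V4
    indep    : ∀ (s : Fin 4 → Bool) → comb s corner ≡ 𝟎 → ∀ i → s i ≡ false
    spanning : ∀ (v : V4) → ∃[ s ] comb s corner ≡ v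
open Tetrahedron public

PointOf : Tetrahedron → V4 → Set
PointOf T x = (∃[ i ] x ≡ corner T i)
            ⊎ (∃[ i ] ∃[ j ] (i ≢ j × x ≡ corner T i ⊕ corner T j))

IsLineOf : Tetrahedron → V4 → V4 → V4 → Set
IsLineOf T x y z = ∃[ i ] ∃[ j ] (i ≢ j ×
  ((x ∷ y ∷ z ∷ []) ↭ (corner T i ∷ corner T j ∷ (corner T i ⊕ corner T j) ∷ [])))

data Shape : Set where
  ls hl ang alt ax dpt : Shape

Distinct3 : Fin 4 → Fin 4 → Fin 4 → Set
Distinct3 i j k = i ≢ j × i ≢ k × j ≢ k

Distinct4 : Fin 4 → Fin 4 → Fin 4 → Fin 4 → Set
Distinct4 i j k l = i ≢ j × i ≢ k × i ≢ l × j ≢ k × j ≢ l × k ≢ l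

UPairEq : V4 → V4 → V4 → V4 → Set
UPairEq x y a b = (x ≡ a × y ≡ b) ⊎ (x ≡ b × y ≡ a)

HasShape : Tetrahedron → Shape → V4 → V4 → Set
HasShape T ls x y = ∃[ i ] ∃[ j ] (i ≢ j × UPairEq x y (corner T i) (corner T j))
HasShape T hl x y = ∃[ i ] ∃[ j ] (i ≢ j ×
  UPairEq x y (corner T i) (corner T i ⊕ corner T j))
HasShape T ang x y = ∃[ i ] ∃[ j ] ∃[ k ] (Distinct3 i j k ×
  UPairEq x y (corner T i ⊕ corner T j) (corner T i ⊕ corner T k))
HasShape T alt x y = ∃[ i ] ∃[ j ] ∃[ k ] (Distinct3 i j k ×
  UPairEq x y (corner T i) (corner T j ⊕ corner T k))
HasShape T ax x y = ∃[ i ] ∃[ j ] ∃[ k ] ∃[ l ] (Distinct4 i j k l ×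
  UPairEq x y (corner T i ⊕ corner T j) (corner T k ⊕ corner T l))
HasShape T dpt x y = PointOf T x × x ≡ y

-- A cubic multipole on n vertices has darts (edge-ends) Fin n × Fin 3,
-- the three darts of vertex v being (v , 0), (v , 1), (v , 2).
-- Edges are the orbits of an involution ι on darts: a 2-element orbit
-- {d , ι d} is an ordinary edge (a loop if both darts lie at the same
-- vertex), a fixed point ι d ≡ d is a dangling edge.

Dart : ℕ → Set
Dart n = Fin n × Fin 3

_≟ᵈ_ : ∀ {n} → DecidableEquality (Dart n)
_≟ᵈ_ = ≡-dec _≟ᶠ_ _≟ᶠ_

vx : ∀ {n} → Dart n → Fin n
vx = proj₁

record CubicGraph : Set where
  field
    n       : ℕ
    ι       : Dart n → Dart n
    ι-invol : ∀ d → ι (ι d) ≡ d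
    ι-nofix : ∀ d → ι d ≢ d
open CubicGraph public

-- a set of edges, given as a set of darts closed under ι
-- perfect matching: every vertex is incident with exactly one edge-end in M
IsPerfectMatching : (G : CubicGraph) → (Dart (n G) → Bool) → Set
IsPerfectMatching G M =
  (∀ d → M (ι G d) ≡ M d) ×
  (∀ v → ∃[ i ] (M (v , i) ≡ true × (∀ j → M (v , j) ≡ true → j ≡ i)))

PMIndexAtLeast5 : CubicGraph → Set
PMIndexAtLeast5 G = ¬ (∃[ Ms ] (length Ms ≤ 4 × All (IsPerfectMatching G) Ms ×
                        (∀ d → Any (λ M → M d ≡ true) Ms)))

next5 : Fin 5 → Fin 5
next5 zero = suc zero
next5 (suc zero) = suc (suc zero)
next5 (suc (suc zero)) = suc (suc (suc zero))
next5 (suc (suc (suc zero))) = suc (suc (suc (suc zero)))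
next5 (suc (suc (suc (suc zero)))) = zero

record FiveCycle (G : CubicGraph) : Set where
  field
    w      : Fin 5 → Fin (n G)
    w-inj  : ∀ i j → w i ≡ w j → i ≡ j
    a      : Fin 5 → Dart (n G)
    a-src  : ∀ i → vx (a i) ≡ w i
    a-tgt  : ∀ i → vx (ι G (a i)) ≡ w (next5 i)
open FiveCycle public

_∈V_ : ∀ {G} → Fin (n G) → FiveCycle G → Set
v ∈V C = ∃[ i ] v ≡ w C i

_∈E_ : ∀ {G} → Dart (n G) → FiveCycle G → Set
_∈E_ {G} d C = ∃[ i ] (d ≡ a C i ⊎ d ≡ ι G (a C i))

IntersectionIsPath2 : (G : CubicGraph) → FiveCycle G → FiveCycle G → Set
IntersectionIsPath2 G C₁ C₂ =
  Σ (Fin (n G)) λ p₀ → Σ (Fin (n G)) λ p₁ → Σ (Fin (n G)) λ p₂ →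
  Σ (Dart (n G)) λ q₁ → Σ (Dart (n G)) λ q₂ →
    (p₀ ≢ p₁ × p₀ ≢ p₂ × p₁ ≢ p₂) ×
    (vx q₁ ≡ p₀ × vx (ι G q₁) ≡ p₁ × vx q₂ ≡ p₁ × vx (ι G q₂) ≡ p₂) ×
    (∀ v → ((v ∈V C₁ × v ∈V C₂) → (v ≡ p₀ ⊎ v ≡ p₁ ⊎ v ≡ p₂))
         × ((v ≡ p₀ ⊎ v ≡ p₁ ⊎ v ≡ p₂) → (v ∈V C₁ × v ∈V C₂))) ×
    (∀ d → ((d ∈E C₁ × d ∈E C₂) →
              (d ≡ q₁ ⊎ d ≡ ι G q₁ ⊎ d ≡ q₂ ⊎ d ≡ ι G q₂))
         × ((d ≡ q₁ ⊎ d ≡ ι G q₁ ⊎ d ≡ q₂ ⊎ d ≡ ι G q₂) →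
              (d ∈E C₁ × d ∈E C₂)))

OuterEdge : (G : CubicGraph) → FiveCycle G → FiveCycle G → Dart (n G) → Set
OuterEdge G C₁ C₂ d =
  (d ∈E C₁ ⊎ d ∈E C₂) ×
  ¬ (vx d ∈V C₁ × vx d ∈V C₂) ×
  ¬ (vx (ι G d) ∈V C₁ × vx (ι G d) ∈V C₂)

DifferentEdges : (G : CubicGraph) → Dart (n G) → Dart (n G) → Set
DifferentEdges G d d' = d' ≢ d × d' ≢ ι G d

record Pole22 : Set where
  field
    m  : ℕ
    κ  : Dart m → Dart m
    g₁ g₂ : Dart m
    h₁ h₂ : Dart m
open Pole22 public

sever : ∀ {m} → (Dart m → Dart m) → Dart m → (Dart m → Dart m)
sever ι d x = if ⌊ x ≟ᵈ d ⌋ ∨ ⌊ x ≟ᵈ ι d ⌋ then x else ι x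

severTwo : (G : CubicGraph) → Dart (n G) → Dart (n G) → Pole22
severTwo G de df = record
  { m = n G
  ; κ = sever (sever (ι G) de) df
  ; g₁ = de ; g₂ = ι G de
  ; h₁ = df ; h₂ = ι G df }

IsTFlow : (T : Tetrahedron) (X : Pole22) → (Dart (m X) → V4) → Set
IsTFlow T X φ =
  (∀ d → φ (κ X d) ≡ φ d) ×
  (∀ d → PointOf T (φ d)) ×
  (∀ v → IsLineOf T (φ (v , zero)) (φ (v , suc zero)) (φ (v , suc (suc zero))))

Transition : Tetrahedron → Pole22 → Shape → Shape → Set
Transition T X s t = ∃[ φ ] (IsTFlow T X φ ×
  HasShape T s (φ (g₁ X)) (φ (g₂ X)) × HasShape T t (φ (h₁ X)) (φ (h₂ X)))

AllowedTransition : Shape → Shape → Set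
AllowedTransition s t =
    (s ≡ hl  × t ≡ hl)
  ⊎ (s ≡ ls  × t ≡ ls)
  ⊎ (s ≡ alt × t ≡ alt)
  ⊎ (s ≡ ang × t ≡ ls)
  ⊎ (s ≡ ls  × t ≡ ang)

-- Summing the line equations x + y + z = 0 of a T-flow over all vertices, every inner edge
-- cancels, so φ(g₁) + φ(g₂) = φ(h₁) + φ(h₂).  Written in the basis of corners, the sum of a
-- pair has 2, 1, 2, 3, 4 or 0 corners according as its shape is ls, hl, ang, alt, ax or dpt,
-- which leaves only dpt → dpt, ang → ang and ax → ax besides the allowed transitions.
-- For dpt → dpt the flow closes up to a T-flow on G, and the corners of T give four perfect
-- matchings covering G, against π(G) ≥ 5.  In the other two cases all four dangling edges
-- carry midpoints; as every line of T has exactly one midpoint, the midpoint-valued darts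
-- form a perfect matching of the pole.  If e and f lie on one 5-cycle, both are its side
-- opposite the middle vertex p₁ of the path C₁ ∩ C₂, so e = f.  Otherwise the edges joining
-- the ends of e and of f to the end vertices p₀ and p₂ of the path are unmatched, which
-- forces both path edges into the matching at p₁.

module Submission where

open import Defs

open import Level using (0ℓ)
open import Algebra.Bundles using (CommutativeMonoid)
import Algebra.Properties.Monoid.Sum as MonoidSum
open import Data.Bool using (Bool; true; false; not; _xor_; if_then_else_)
open import Data.Bool.Properties
  using (xor-assoc; xor-comm; xor-identityˡ; xor-identityʳ; xor-same; ¬-not) renaming (_≟_ to _≟ᵇ_)
open import Data.Empty using (⊥; ⊥-elim)
open import Data.Fin using (Fin; zero; suc)
open import Data.Fin.Patterns using (0F; 1F; 2F; 3F; 4F)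
open import Data.Fin.Properties using (all?; any?) renaming (_≟_ to _≟ᶠ_)
open import Data.List using (List; []; _∷_; map; foldr; tabulate; cartesianProduct; allFin)
open import Data.List.Membership.Propositional using (_∈_; _∉_)
open import Data.List.Membership.Propositional.Properties using (∈-allFin; ∈-cartesianProduct⁺)
open import Data.List.Relation.Binary.Permutation.Propositional using (_↭_; ↭⇒↭ₛ)
open import Data.List.Relation.Binary.Permutation.Propositional.Properties using (map⁺)
open import Data.List.Relation.Binary.Permutation.Setoid.Properties using (foldr-commMonoid)
import Data.List.Relation.Unary.All.Properties as All
open import Data.List.Relation.Unary.Any using (Any; here; there)
import Data.List.Relation.Unary.Any.Properties as Any
open import Data.Nat using (ℕ; _≡ᵇ_) renaming (_≟_ to _≟ⁿ_)
import Data.Nat.ListAction as ℕ-List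
open import Data.Nat.ListAction.Properties using (sum-↭)
open import Data.Nat.Properties using (+-0-monoid; ≤-refl)
open import Data.Product using (Σ; ∃-syntax; _×_; _,_; proj₁; proj₂)
open import Data.Sum using (_⊎_; inj₁; inj₂)
open import Data.Unit using (tt)
open import Data.Vec.Properties
  using (map-id; zipWith-assoc; zipWith-comm; zipWith-identityˡ; zipWith-identityʳ; zipWith-inverseˡ)
open import Function using (_∘_)
open import Relation.Nullary using (¬_; Dec; does; yes; no; ¬?)
open import Relation.Nullary.Decidable using (toSum; toWitness; _×-dec_; _⊎-dec_; _→-dec_)
open import Relation.Binary.PropositionalEquality

⊕-assoc : ∀ x y z → (x ⊕ y) ⊕ z ≡ x ⊕ (y ⊕ z)
⊕-assoc = zipWith-assoc xor-assoc

⊕-comm : ∀ x y → x ⊕ y ≡ y ⊕ x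
⊕-comm = zipWith-comm xor-comm

⊕-identityˡ : ∀ x → 𝟎 ⊕ x ≡ x
⊕-identityˡ = zipWith-identityˡ xor-identityˡ

⊕-identityʳ : ∀ x → x ⊕ 𝟎 ≡ x
⊕-identityʳ = zipWith-identityʳ xor-identityʳ

⊕-self : ∀ x → x ⊕ x ≡ 𝟎
⊕-self x = trans (cong (_⊕ x) (sym (map-id x))) (zipWith-inverseˡ xor-same x)

⊕-cancelˡ : ∀ x y → x ⊕ (x ⊕ y) ≡ y
⊕-cancelˡ x y = begin
  x ⊕ (x ⊕ y) ≡⟨ ⊕-assoc x x y ⟨
  (x ⊕ x) ⊕ y ≡⟨ cong (_⊕ y) (⊕-self x) ⟩
  𝟎 ⊕ y       ≡⟨ ⊕-identityˡ y ⟩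
  y           ∎
  where open ≡-Reasoning

⊕≡𝟎⇒≡ : ∀ {x y} → x ⊕ y ≡ 𝟎 → x ≡ y
⊕≡𝟎⇒≡ {x} {y} eq = begin
  x             ≡⟨ ⊕-cancelˡ y x ⟨
  y ⊕ (y ⊕ x)   ≡⟨ cong (y ⊕_) (trans (⊕-comm y x) eq) ⟩
  y ⊕ 𝟎         ≡⟨ ⊕-identityʳ y ⟩
  y             ∎
  where open ≡-Reasoning

⊕-commutativeMonoid : CommutativeMonoid 0ℓ 0ℓ
⊕-commutativeMonoid = record
  { isCommutativeMonoid = record
    { isMonoid = record
      { isSemigroup = record
        { isMagma = record { isEquivalence = isEquivalence ; ∙-cong = cong₂ _⊕_ }
        ; assoc = ⊕-assoc }
      ; identity = ⊕-identityˡ , ⊕-identityʳ }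
    ; comm = ⊕-comm } }

open import Algebra.Properties.CommutativeMonoid.Sum ⊕-commutativeMonoid
  using (sum; sum-syntax; ∑-distrib-+; sum-cong-≗; sum-replicate-zero)

sel-sum : ∀ {n} b (f : Fin n → V4) → ∑[ k < n ] sel b (f k) ≡ sel b (sum f)
sel-sum         true  f = refl
sel-sum {n = n} false f = sum-replicate-zero n

∑-δ : ∀ {n} (f : Fin n → V4) i → ∑[ k < n ] sel (does (k ≟ᶠ i)) (f k) ≡ f i
∑-δ f (zero {n}) = trans (cong (f zero ⊕_) (sum-replicate-zero n)) (⊕-identityʳ (f zero))
∑-δ f (suc {n} i) = trans (⊕-identityˡ _) (∑-δ {n} (λ k → f (suc k)) i)

Σᵈ : ∀ {n} → (Dart n → V4) → V4
Σᵈ {n} g = ∑[ v < n ] ∑[ j < 3 ] g (v , j)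

Σᵈ-⊕ : ∀ {n} (g h : Dart n → V4) → Σᵈ (λ d → g d ⊕ h d) ≡ Σᵈ g ⊕ Σᵈ h
Σᵈ-⊕ g h = trans (sum-cong-≗ λ v → ∑-distrib-+ (λ j → g (v , j)) (λ j → h (v , j)))
                 (∑-distrib-+ (λ v → ∑[ j < 3 ] g (v , j)) (λ v → ∑[ j < 3 ] h (v , j)))

Σᵈ-cong : ∀ {n} {g h : Dart n → V4} → (∀ d → g d ≡ h d) → Σᵈ g ≡ Σᵈ h
Σᵈ-cong g≗h = sum-cong-≗ λ v → sum-cong-≗ λ j → g≗h (v , j)

Σᵈ-δ : ∀ {n} (g : Dart n → V4) x → Σᵈ (λ d → sel (does (d ≟ᵈ x)) (g d)) ≡ g x
Σᵈ-δ {n} g (a , b) = begin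
  Σᵈ (λ d → sel (does (d ≟ᵈ (a , b))) (g d))
    ≡⟨ Σᵈ-cong split ⟩
  ∑[ v < n ] ∑[ j < 3 ] sel (does (v ≟ᶠ a)) (sel (does (j ≟ᶠ b)) (g (v , j)))
    ≡⟨ sum-cong-≗ (λ v → sel-sum (does (v ≟ᶠ a)) (λ j → sel (does (j ≟ᶠ b)) (g (v , j)))) ⟩
  ∑[ v < n ] sel (does (v ≟ᶠ a)) (∑[ j < 3 ] sel (does (j ≟ᶠ b)) (g (v , j)))
    ≡⟨ sum-cong-≗ (λ v → cong (sel (does (v ≟ᶠ a))) (∑-δ (λ j → g (v , j)) b)) ⟩
  ∑[ v < n ] sel (does (v ≟ᶠ a)) (g (v , b))
    ≡⟨ ∑-δ (λ v → g (v , b)) a ⟩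
  g (a , b) ∎
  where
  open ≡-Reasoning
  split : ∀ d → sel (does (d ≟ᵈ (a , b))) (g d) ≡ sel (does (proj₁ d ≟ᶠ a)) (sel (does (proj₂ d ≟ᶠ b)) (g d))
  split (v , j) with v ≟ᶠ a
  ... | yes refl = refl
  ... | no _     = refl

_[_≔_] : ∀ {n} → (Dart n → V4) → Dart n → V4 → Dart n → V4
(g [ x ≔ v ]) d = if does (d ≟ᵈ x) then v else g d

update-same : ∀ {n} (g : Dart n → V4) x v → (g [ x ≔ v ]) x ≡ v
update-same g x v with x ≟ᵈ x
... | yes _  = refl
... | no x≢x = ⊥-elim (x≢x refl)

update-other : ∀ {n} (g : Dart n → V4) {x d} v → d ≢ x → (g [ x ≔ v ]) d ≡ g d
update-other g {x} {d} v d≢x with d ≟ᵈ x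
... | yes d≡x = ⊥-elim (d≢x d≡x)
... | no _    = refl

Σᵈ-update : ∀ {n} (g : Dart n → V4) x v → Σᵈ (g [ x ≔ v ]) ≡ Σᵈ g ⊕ (g x ⊕ v)
Σᵈ-update g x v = begin
  Σᵈ (g [ x ≔ v ])                                   ≡⟨ Σᵈ-cong decompose ⟩
  Σᵈ (λ d → g d ⊕ sel (does (d ≟ᵈ x)) (g d ⊕ v))    ≡⟨ Σᵈ-⊕ g (λ d → sel (does (d ≟ᵈ x)) (g d ⊕ v)) ⟩
  Σᵈ g ⊕ Σᵈ (λ d → sel (does (d ≟ᵈ x)) (g d ⊕ v))   ≡⟨ cong (Σᵈ g ⊕_) (Σᵈ-δ (λ d → g d ⊕ v) x) ⟩
  Σᵈ g ⊕ (g x ⊕ v)                                   ∎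
  where
  open ≡-Reasoning
  decompose : ∀ d → (g [ x ≔ v ]) d ≡ g d ⊕ sel (does (d ≟ᵈ x)) (g d ⊕ v)
  decompose d with d ≟ᵈ x
  ... | yes refl = sym (⊕-cancelˡ (g x) v)
  ... | no _     = sym (⊕-identityʳ (g d))

Σᵈ-zero : ∀ {n} → Σᵈ {n} (λ _ → 𝟎) ≡ 𝟎
Σᵈ-zero {n} = trans (sum-cong-≗ {n} (λ _ → sum-replicate-zero 3)) (sum-replicate-zero n)

⊕-foldr-↭ : ∀ {xs ys} → xs ↭ ys → foldr _⊕_ 𝟎 xs ≡ foldr _⊕_ 𝟎 ys
⊕-foldr-↭ p = foldr-commMonoid (setoid V4) isCommutativeMonoid (↭⇒↭ₛ p)
  where open CommutativeMonoid ⊕-commutativeMonoid using (isCommutativeMonoid)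

line-sum : ∀ T {x y z} → IsLineOf T x y z → foldr _⊕_ 𝟎 (x ∷ y ∷ z ∷ []) ≡ 𝟎
line-sum T (i , j , _ , p) = begin
  foldr _⊕_ 𝟎 (_ ∷ _ ∷ _ ∷ [])     ≡⟨ ⊕-foldr-↭ p ⟩
  c i ⊕ (c j ⊕ ((c i ⊕ c j) ⊕ 𝟎)) ≡⟨ cong (λ u → c i ⊕ (c j ⊕ u)) (⊕-identityʳ (c i ⊕ c j)) ⟩
  c i ⊕ (c j ⊕ (c i ⊕ c j))       ≡⟨ cong (λ u → c i ⊕ (c j ⊕ u)) (⊕-comm (c i) (c j)) ⟩
  c i ⊕ (c j ⊕ (c j ⊕ c i))       ≡⟨ cong (c i ⊕_) (⊕-cancelˡ (c j) (c i)) ⟩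
  c i ⊕ c i                       ≡⟨ ⊕-self (c i) ⟩
  𝟎                               ∎
  where
  open ≡-Reasoning
  c = corner T

Σᵈ-lines : ∀ T {m} (φ : Dart m → V4) → (∀ v → IsLineOf T (φ (v , 0F)) (φ (v , 1F)) (φ (v , 2F))) → Σᵈ φ ≡ 𝟎
Σᵈ-lines T {m} φ lines = trans (sum-cong-≗ (λ v → line-sum T (lines v))) (sum-replicate-zero m)

allDarts : ∀ n → List (Dart n)
allDarts n = cartesianProduct (allFin n) (allFin 3)

∈-allDarts : ∀ {n} (d : Dart n) → d ∈ allDarts n
∈-allDarts (v , j) = ∈-cartesianProduct⁺ (∈-allFin v) (∈-allFin j)

∉-∷ : ∀ {n} {d x : Dart n} {xs} → d ≢ x → d ∉ xs → d ∉ x ∷ xs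
∉-∷ d≢x d∉xs (here d≡x)  = d≢x d≡x
∉-∷ d≢x d∉xs (there d∈xs) = d∉xs d∈xs

module _ (G : CubicGraph) where

  private
    D = Dart (n G)

  ι-injective : ∀ {d d′ : D} → ι G d ≡ ι G d′ → d ≡ d′
  ι-injective {d} {d′} eq = trans (sym (ι-invol G d)) (trans (cong (ι G) eq) (ι-invol G d′))

  ι-cancel : ∀ {d x : D} → ι G d ≡ x → d ≡ ι G x
  ι-cancel {d} eq = trans (sym (ι-invol G d)) (cong (ι G) eq)

  ≢ι : ∀ (d : D) → d ≢ ι G d
  ≢ι d eq = ι-nofix G d (sym eq)

  InvariantOff : List D → (D → V4) → Set
  InvariantOff xs g = ∀ d → d ∉ xs → g (ι G d) ≡ g d

  erase : D → (D → V4) → D → V4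
  erase x g = (g [ x ≔ 𝟎 ]) [ ι G x ≔ 𝟎 ]

  erase-self : ∀ x g → erase x g x ≡ 𝟎
  erase-self x g = trans (update-other (g [ x ≔ 𝟎 ]) 𝟎 (≢ι x)) (update-same g x 𝟎)

  erase-ι : ∀ x g → erase x g (ι G x) ≡ 𝟎
  erase-ι x g = update-same (g [ x ≔ 𝟎 ]) (ι G x) 𝟎

  erase-other : ∀ x g {d} → d ≢ x → d ≢ ι G x → erase x g d ≡ g d
  erase-other x g d≢x d≢ιx = trans (update-other (g [ x ≔ 𝟎 ]) 𝟎 d≢ιx) (update-other g 𝟎 d≢x)

  erase-invariant : ∀ x g → InvariantOff [] g → InvariantOff [] (erase x g)
  erase-invariant x g inv d _ with toSum (d ≟ᵈ x) | toSum (d ≟ᵈ ι G x)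
  ... | inj₁ refl | _         = trans (erase-ι x g) (sym (erase-self x g))
  ... | inj₂ _    | inj₁ refl =
    trans (cong (erase x g) (ι-invol G x)) (trans (erase-self x g) (sym (erase-ι x g)))
  ... | inj₂ d≢x  | inj₂ d≢ιx = begin
    erase x g (ι G d) ≡⟨ erase-other x g (d≢ιx ∘ ι-cancel) (d≢x ∘ ι-injective) ⟩
    g (ι G d)         ≡⟨ inv d (λ ()) ⟩
    g d               ≡⟨ erase-other x g d≢x d≢ιx ⟨
    erase x g d       ∎
    where open ≡-Reasoning

  Σᵈ-erase : ∀ x g → g (ι G x) ≡ g x → Σᵈ (erase x g) ≡ Σᵈ g
  Σᵈ-erase x g edge = begin
    Σᵈ (erase x g)                                    ≡⟨ Σᵈ-update (g [ x ≔ 𝟎 ]) (ι G x) 𝟎 ⟩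
    Σᵈ (g [ x ≔ 𝟎 ]) ⊕ ((g [ x ≔ 𝟎 ]) (ι G x) ⊕ 𝟎)  ≡⟨ cong₂ _⊕_ (Σᵈ-update g x 𝟎) (⊕-identityʳ _) ⟩
    (Σᵈ g ⊕ (g x ⊕ 𝟎)) ⊕ (g [ x ≔ 𝟎 ]) (ι G x)       ≡⟨ cong₂ (λ u v → (Σᵈ g ⊕ u) ⊕ v) (⊕-identityʳ (g x))
                                                              (trans (update-other g 𝟎 (≢ι x ∘ sym)) edge) ⟩
    (Σᵈ g ⊕ g x) ⊕ g x                                ≡⟨ ⊕-assoc (Σᵈ g) (g x) (g x) ⟩
    Σᵈ g ⊕ (g x ⊕ g x)                                ≡⟨ cong (Σᵈ g ⊕_) (⊕-self (g x)) ⟩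
    Σᵈ g ⊕ 𝟎                                          ≡⟨ ⊕-identityʳ (Σᵈ g) ⟩
    Σᵈ g                                              ∎
    where open ≡-Reasoning

  -- The two darts of an edge carry the same value and cancel; erase the edges one at a time.
  Σᵈ-invariant-supported : ∀ xs g → InvariantOff [] g → (∀ d → d ∉ xs → g d ≡ 𝟎) → Σᵈ g ≡ 𝟎
  Σᵈ-invariant-supported []       g inv out = trans (Σᵈ-cong (λ d → out d (λ ()))) (Σᵈ-zero {n G})
  Σᵈ-invariant-supported (x ∷ xs) g inv out =
    trans (sym (Σᵈ-erase x g (inv x (λ ()))))
          (Σᵈ-invariant-supported xs (erase x g) (erase-invariant x g inv) out′)
    where
    out′ : ∀ d → d ∉ xs → erase x g d ≡ 𝟎
    out′ d d∉xs with toSum (d ≟ᵈ x) | toSum (d ≟ᵈ ι G x)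
    ... | inj₁ refl | _         = erase-self x g
    ... | inj₂ _    | inj₁ refl = erase-ι x g
    ... | inj₂ d≢x  | inj₂ d≢ιx = trans (erase-other x g d≢x d≢ιx) (out d (∉-∷ d≢x d∉xs))

  Σᵈ-invariant : ∀ g → InvariantOff [] g → Σᵈ g ≡ 𝟎
  Σᵈ-invariant g inv = Σᵈ-invariant-supported (allDarts (n G)) g inv (λ d d∉ → ⊥-elim (d∉ (∈-allDarts d)))

  repair : D → (D → V4) → D → V4
  repair x g = g [ ι G x ≔ g x ]

  repair-invariant : ∀ x xs g → InvariantOff (x ∷ ι G x ∷ xs) g → InvariantOff xs (repair x g)
  repair-invariant x xs g inv d d∉xs with toSum (d ≟ᵈ x) | toSum (d ≟ᵈ ι G x)
  ... | inj₁ refl | _         = trans (update-same g (ι G x) (g x)) (sym (update-other g (g x) (≢ι x)))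
  ... | inj₂ _    | inj₁ refl = begin
    repair x g (ι G (ι G x)) ≡⟨ cong (repair x g) (ι-invol G x) ⟩
    repair x g x             ≡⟨ update-other g (g x) (≢ι x) ⟩
    g x                      ≡⟨ update-same g (ι G x) (g x) ⟨
    repair x g (ι G x)       ∎
    where open ≡-Reasoning
  ... | inj₂ d≢x  | inj₂ d≢ιx = begin
    repair x g (ι G d) ≡⟨ update-other g (g x) (d≢x ∘ ι-injective) ⟩
    g (ι G d)          ≡⟨ inv d (∉-∷ d≢x (∉-∷ d≢ιx d∉xs)) ⟩
    g d                ≡⟨ update-other g (g x) d≢ιx ⟨
    repair x g d       ∎
    where open ≡-Reasoning

  -- Repairing the two severed edges gives an invariant function; each repair changes the
  -- dart sum by the defect of its edge.
  conservation : ∀ (φ : D → V4) {e f} → DifferentEdges G e f →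
                 InvariantOff (e ∷ ι G e ∷ f ∷ ι G f ∷ []) φ → Σᵈ φ ≡ 𝟎 →
                 φ e ⊕ φ (ι G e) ≡ φ f ⊕ φ (ι G f)
  conservation φ {e} {f} (f≢e , f≢ιe) inv Σφ≡𝟎 = begin
    φ e ⊕ φ (ι G e) ≡⟨ ⊕-comm (φ e) (φ (ι G e)) ⟩
    φ (ι G e) ⊕ φ e ≡⟨ ⊕≡𝟎⇒≡ defects-cancel ⟩
    φ (ι G f) ⊕ φ f ≡⟨ ⊕-comm (φ (ι G f)) (φ f) ⟩
    φ f ⊕ φ (ι G f) ∎
    where
    open ≡-Reasoning
    φ₁ = repair e φ
    ψ  = repair f φ₁
    ψ-invariant : InvariantOff [] ψ
    ψ-invariant = repair-invariant f [] φ₁ (repair-invariant e (f ∷ ι G f ∷ []) φ inv)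
    defectₑ = φ (ι G e) ⊕ φ e
    defect₁ = φ₁ (ι G f) ⊕ φ₁ f
    defect₁≡ : defect₁ ≡ φ (ι G f) ⊕ φ f
    defect₁≡ = cong₂ _⊕_ (update-other φ (φ e) (f≢e ∘ ι-injective)) (update-other φ (φ e) f≢ιe)
    defects-cancel : defectₑ ⊕ (φ (ι G f) ⊕ φ f) ≡ 𝟎
    defects-cancel = begin
      defectₑ ⊕ (φ (ι G f) ⊕ φ f) ≡⟨ cong₂ _⊕_ (⊕-identityˡ defectₑ) defect₁≡ ⟨
      (𝟎 ⊕ defectₑ) ⊕ defect₁     ≡⟨ cong (λ z → (z ⊕ defectₑ) ⊕ defect₁) Σφ≡𝟎 ⟨
      (Σᵈ φ ⊕ defectₑ) ⊕ defect₁  ≡⟨ cong (_⊕ defect₁) (Σᵈ-update φ (ι G e) (φ e)) ⟨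
      Σᵈ φ₁ ⊕ defect₁             ≡⟨ Σᵈ-update φ₁ (ι G f) (φ₁ f) ⟨
      Σᵈ ψ                        ≡⟨ Σᵈ-invariant ψ ψ-invariant ⟩
      𝟎                           ∎

  seal : ∀ x xs g → InvariantOff (x ∷ ι G x ∷ xs) g → g (ι G x) ≡ g x → InvariantOff xs g
  seal x xs g inv edge d d∉xs with toSum (d ≟ᵈ x) | toSum (d ≟ᵈ ι G x)
  ... | inj₁ refl | _         = edge
  ... | inj₂ _    | inj₁ refl = trans (cong g (ι-invol G x)) (sym edge)
  ... | inj₂ d≢x  | inj₂ d≢ιx = inv d (∉-∷ d≢x (∉-∷ d≢ιx d∉xs))

Coords : Set
Coords = Fin 4 → Bool

_⊻_ : Coords → Coords → Coords
(σ ⊻ τ) k = σ k xor τ k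

δ : Fin 4 → Coords
δ i k = does (k ≟ᶠ i)

module ℕ-Sum = MonoidSum +-0-monoid

weight : Coords → ℕ
weight σ = ℕ-Sum.sum (λ k → if σ k then 1 else 0)

weight-cong : ∀ {σ τ} → (∀ k → σ k ≡ τ k) → weight σ ≡ weight τ
weight-cong σ≗τ = ℕ-Sum.sum-cong-≗ (λ k → cong (λ b → if b then 1 else 0) (σ≗τ k))

weight-δ : ∀ i → weight (δ i) ≡ 1
weight-δ = toWitness {a? = all? λ i → weight (δ i) ≟ⁿ 1} tt

weight-δ₂ : ∀ i j → i ≢ j → weight (δ i ⊻ δ j) ≡ 2
weight-δ₂ = toWitness {a? = all? λ i → all? λ j → ¬? (i ≟ᶠ j) →-dec weight (δ i ⊻ δ j) ≟ⁿ 2} tt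

weight-δ₃ : ∀ i j k → Distinct3 i j k → weight (δ i ⊻ (δ j ⊻ δ k)) ≡ 3
weight-δ₃ = toWitness {a? = all? λ i → all? λ j → all? λ k →
  (¬? (i ≟ᶠ j) ×-dec ¬? (i ≟ᶠ k) ×-dec ¬? (j ≟ᶠ k)) →-dec weight (δ i ⊻ (δ j ⊻ δ k)) ≟ⁿ 3} tt

weight-δ₄ : ∀ i j k l → Distinct4 i j k l → weight ((δ i ⊻ δ j) ⊻ (δ k ⊻ δ l)) ≡ 4
weight-δ₄ = toWitness {a? = all? λ i → all? λ j → all? λ k → all? λ l →
  (¬? (i ≟ᶠ j) ×-dec ¬? (i ≟ᶠ k) ×-dec ¬? (i ≟ᶠ l) ×-dec ¬? (j ≟ᶠ k) ×-dec ¬? (j ≟ᶠ l) ×-dec ¬? (k ≟ᶠ l))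
  →-dec weight ((δ i ⊻ δ j) ⊻ (δ k ⊻ δ l)) ≟ⁿ 4} tt

sel-xor : ∀ a b v → sel (a xor b) v ≡ sel a v ⊕ sel b v
sel-xor false b v = sym (⊕-identityˡ (sel b v))
sel-xor true false v = sym (⊕-identityʳ v)
sel-xor true true v = sym (⊕-self v)

comb-∑ : ∀ σ c → comb σ c ≡ ∑[ k < 4 ] sel (σ k) (c k)
comb-∑ σ c = cong (λ u → s 0F ⊕ (s 1F ⊕ (s 2F ⊕ u))) (sym (⊕-identityʳ (s 3F)))
  where
  s : Fin 4 → V4
  s k = sel (σ k) (c k)

comb-⊻ : ∀ σ τ c → comb (σ ⊻ τ) c ≡ comb σ c ⊕ comb τ c
comb-⊻ σ τ c = begin
  comb (σ ⊻ τ) c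
    ≡⟨ comb-∑ (σ ⊻ τ) c ⟩
  ∑[ k < 4 ] sel (σ k xor τ k) (c k)
    ≡⟨ sum-cong-≗ (λ k → sel-xor (σ k) (τ k) (c k)) ⟩
  ∑[ k < 4 ] (sel (σ k) (c k) ⊕ sel (τ k) (c k))
    ≡⟨ ∑-distrib-+ (λ k → sel (σ k) (c k)) (λ k → sel (τ k) (c k)) ⟩
  (∑[ k < 4 ] sel (σ k) (c k)) ⊕ (∑[ k < 4 ] sel (τ k) (c k))
    ≡⟨ cong₂ _⊕_ (comb-∑ σ c) (comb-∑ τ c) ⟨
  comb σ c ⊕ comb τ c ∎
  where open ≡-Reasoning

comb-δ : ∀ i c → comb (δ i) c ≡ c i
comb-δ i c = trans (comb-∑ (δ i) c) (∑-δ c i)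

xor≡false⇒≡ : ∀ {a b} → a xor b ≡ false → a ≡ b
xor≡false⇒≡ {false} {false} _ = refl
xor≡false⇒≡ {true}  {true}  _ = refl
xor≡false⇒≡ {false} {true}  ()
xor≡false⇒≡ {true}  {false} ()

upair-⊕ : ∀ {x y a b} → UPairEq x y a b → x ⊕ y ≡ a ⊕ b
upair-⊕ (inj₁ (refl , refl)) = refl
upair-⊕ (inj₂ (refl , refl)) = ⊕-comm _ _

shapeRank : Shape → ℕ
shapeRank ls  = 2
shapeRank hl  = 1
shapeRank ang = 2
shapeRank alt = 3
shapeRank ax  = 4
shapeRank dpt = 0

module _ (T : Tetrahedron) where

  private
    c = corner T

  coords : V4 → Coords
  coords x = proj₁ (spanning T x)

  comb-injective : ∀ σ τ → comb σ c ≡ comb τ c → ∀ k → σ k ≡ τ k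
  comb-injective σ τ eq k = xor≡false⇒≡ (indep T (σ ⊻ τ) (begin
    comb (σ ⊻ τ) c      ≡⟨ comb-⊻ σ τ c ⟩
    comb σ c ⊕ comb τ c ≡⟨ cong (_⊕ comb τ c) eq ⟩
    comb τ c ⊕ comb τ c ≡⟨ ⊕-self (comb τ c) ⟩
    𝟎                   ∎) k)
    where open ≡-Reasoning

  coords-comb : ∀ σ k → coords (comb σ c) k ≡ σ k
  coords-comb σ = comb-injective (coords (comb σ c)) σ (proj₂ (spanning T (comb σ c)))

  rank : V4 → ℕ
  rank x = weight (coords x)

  rank-comb : ∀ σ → rank (comb σ c) ≡ weight σ
  rank-comb σ = weight-cong (coords-comb σ)

  corner-⊕ : ∀ i j → c i ⊕ c j ≡ comb (δ i ⊻ δ j) c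
  corner-⊕ i j = begin
    c i ⊕ c j                 ≡⟨ cong₂ _⊕_ (comb-δ i c) (comb-δ j c) ⟨
    comb (δ i) c ⊕ comb (δ j) c ≡⟨ comb-⊻ (δ i) (δ j) c ⟨
    comb (δ i ⊻ δ j) c        ∎
    where open ≡-Reasoning

  rank-corner : ∀ i → rank (c i) ≡ 1
  rank-corner i = trans (cong rank (sym (comb-δ i c))) (trans (rank-comb (δ i)) (weight-δ i))

  rank-⊕-comb : ∀ σ τ → rank (comb σ c ⊕ comb τ c) ≡ weight (σ ⊻ τ)
  rank-⊕-comb σ τ = trans (cong rank (sym (comb-⊻ σ τ c))) (rank-comb (σ ⊻ τ))

  rank-mid : ∀ {i j} → i ≢ j → rank (c i ⊕ c j) ≡ 2
  rank-mid {i} {j} i≢j = trans (cong rank (corner-⊕ i j)) (trans (rank-comb (δ i ⊻ δ j)) (weight-δ₂ i j i≢j))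

  shape-rank : ∀ s {x y} → HasShape T s x y → rank (x ⊕ y) ≡ shapeRank s
  shape-rank ls (i , j , i≢j , xy) = trans (cong rank (upair-⊕ xy)) (rank-mid i≢j)
  shape-rank hl (i , j , i≢j , xy) =
    trans (cong rank (trans (upair-⊕ xy) (⊕-cancelˡ (c i) (c j)))) (rank-corner j)
  shape-rank ang (i , j , k , (_ , _ , j≢k) , xy) =
    trans (cong rank (trans (upair-⊕ xy) (angle-⊕ i j k))) (rank-mid j≢k)
    where
    angle-⊕ : ∀ i j k → (c i ⊕ c j) ⊕ (c i ⊕ c k) ≡ c j ⊕ c k
    angle-⊕ i j k = begin
      (c i ⊕ c j) ⊕ (c i ⊕ c k) ≡⟨ ⊕-assoc (c i) (c j) (c i ⊕ c k) ⟩
      c i ⊕ (c j ⊕ (c i ⊕ c k)) ≡⟨ cong (c i ⊕_) (trans (⊕-comm (c j) _) (⊕-assoc (c i) (c k) (c j))) ⟩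
      c i ⊕ (c i ⊕ (c k ⊕ c j)) ≡⟨ ⊕-cancelˡ (c i) (c k ⊕ c j) ⟩
      c k ⊕ c j                 ≡⟨ ⊕-comm (c k) (c j) ⟩
      c j ⊕ c k                 ∎
      where open ≡-Reasoning
  shape-rank alt (i , j , k , ijk , xy) = begin
    rank (_ ⊕ _)                             ≡⟨ cong rank (upair-⊕ xy) ⟩
    rank (c i ⊕ (c j ⊕ c k))                 ≡⟨ cong rank (cong₂ _⊕_ (comb-δ i c) (sym (corner-⊕ j k))) ⟨
    rank (comb (δ i) c ⊕ comb (δ j ⊻ δ k) c) ≡⟨ rank-⊕-comb (δ i) (δ j ⊻ δ k) ⟩
    weight (δ i ⊻ (δ j ⊻ δ k))               ≡⟨ weight-δ₃ i j k ijk ⟩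
    3                                        ∎
    where open ≡-Reasoning
  shape-rank ax (i , j , k , l , ijkl , xy) = begin
    rank (_ ⊕ _)                                   ≡⟨ cong rank (upair-⊕ xy) ⟩
    rank ((c i ⊕ c j) ⊕ (c k ⊕ c l))               ≡⟨ cong rank (cong₂ _⊕_ (corner-⊕ i j) (corner-⊕ k l)) ⟩
    rank (comb (δ i ⊻ δ j) c ⊕ comb (δ k ⊻ δ l) c) ≡⟨ rank-⊕-comb (δ i ⊻ δ j) (δ k ⊻ δ l) ⟩
    weight ((δ i ⊻ δ j) ⊻ (δ k ⊻ δ l))             ≡⟨ weight-δ₄ i j k l ijkl ⟩
    4                                              ∎
    where open ≡-Reasoning
  shape-rank dpt {x} (_ , refl) = trans (cong rank (⊕-self x)) (rank-comb (λ _ → false))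

trues : List Bool → ℕ
trues bs = ℕ-List.sum (map (λ b → if b then 1 else 0) bs)

UniqueAt : (Fin 3 → Bool) → Set
UniqueAt b = ∃[ i ] (b i ≡ true × (∀ j → b j ≡ true → j ≡ i))

unique-at : ∀ {b : Fin 3 → Bool} i → b i ≡ true → (∀ j → j ≢ i → b j ≡ false) → UniqueAt b
unique-at {b} i bi others = i , bi , only
  where
  only : ∀ j → b j ≡ true → j ≡ i
  only j bj with j ≟ᶠ i
  ... | yes j≡i = j≡i
  ... | no j≢i  with () ← trans (sym bj) (others j j≢i)

unique-of-trues : ∀ (b : Fin 3 → Bool) → trues (b 0F ∷ b 1F ∷ b 2F ∷ []) ≡ 1 → UniqueAt b
unique-of-trues b one with b 0F in b₀ | b 1F in b₁ | b 2F in b₂ | one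
... | true  | false | false | _ = unique-at 0F b₀ λ { 0F 0≢0 → ⊥-elim (0≢0 refl) ; 1F _ → b₁ ; 2F _ → b₂ }
... | false | true  | false | _ = unique-at 1F b₁ λ { 0F _ → b₀ ; 1F 1≢1 → ⊥-elim (1≢1 refl) ; 2F _ → b₂ }
... | false | false | true  | _ = unique-at 2F b₂ λ { 0F _ → b₀ ; 1F _ → b₁ ; 2F 2≢2 → ⊥-elim (2≢2 refl) }
... | true  | true  | _     | ()
... | true  | false | true  | ()
... | false | true  | true  | ()
... | false | false | false | ()

-- The perfect matching M_m of a T-flow consists of the edges valued c_m or c_k + c_l with
-- m ∉ {k, l}; every line of T contains exactly one such point.
inMatching : Fin 4 → Coords → Bool
inMatching m σ = if weight σ ≡ᵇ 1 then σ m else not (σ m)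

inMatching-cong : ∀ m {σ τ} → (∀ k → σ k ≡ τ k) → inMatching m σ ≡ inMatching m τ
inMatching-cong m {σ} {τ} σ≗τ = cong₂ (λ w b → if w ≡ᵇ 1 then b else not b) (weight-cong σ≗τ) (σ≗τ m)

inMatching-line : ∀ m i j → i ≢ j →
  trues (inMatching m (δ i) ∷ inMatching m (δ j) ∷ inMatching m (δ i ⊻ δ j) ∷ []) ≡ 1
inMatching-line = toWitness {a? = all? λ m → all? λ i → all? λ j → ¬? (i ≟ᶠ j) →-dec
  trues (inMatching m (δ i) ∷ inMatching m (δ j) ∷ inMatching m (δ i ⊻ δ j) ∷ []) ≟ⁿ 1} tt

inMatching-corner : ∀ i → inMatching i (δ i) ≡ true
inMatching-corner = toWitness {a? = all? λ i → inMatching i (δ i) ≟ᵇ true} tt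

inMatching-mid : ∀ i j → i ≢ j → ∃[ m ] inMatching m (δ i ⊻ δ j) ≡ true
inMatching-mid = toWitness {a? = all? λ i → all? λ j → ¬? (i ≟ᶠ j) →-dec
  any? λ m → inMatching m (δ i ⊻ δ j) ≟ᵇ true} tt

module _ (T : Tetrahedron) where

  private
    c = corner T

  line-unique : ∀ (Q : V4 → Bool) →
    (∀ i j → i ≢ j → trues (map Q (c i ∷ c j ∷ (c i ⊕ c j) ∷ [])) ≡ 1) →
    ∀ (u : Fin 3 → V4) → IsLineOf T (u 0F) (u 1F) (u 2F) → UniqueAt (Q ∘ u)
  line-unique Q one u (i , j , i≢j , p) =
    unique-of-trues (Q ∘ u) (trans (sum-↭ (map⁺ (λ b → if b then 1 else 0) (map⁺ Q p))) (one i j i≢j))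

  isMid : V4 → Bool
  isMid x = rank T x ≡ᵇ 2

  isMid-corner : ∀ i → isMid (c i) ≡ false
  isMid-corner i = cong (_≡ᵇ 2) (rank-corner T i)

  isMid-mid : ∀ {i j} → i ≢ j → isMid (c i ⊕ c j) ≡ true
  isMid-mid i≢j = cong (_≡ᵇ 2) (rank-mid T i≢j)

  line-one-mid : ∀ (u : Fin 3 → V4) → IsLineOf T (u 0F) (u 1F) (u 2F) → UniqueAt (isMid ∘ u)
  line-one-mid = line-unique isMid λ i j i≢j →
    cong₂ (λ a b → trues (a ∷ b)) (isMid-corner i) (cong₂ _∷_ (isMid-corner j) (cong (_∷ []) (isMid-mid i≢j)))

  matching : Fin 4 → V4 → Bool
  matching m x = inMatching m (coords T x)

  matching-comb : ∀ m σ → matching m (comb σ c) ≡ inMatching m σ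
  matching-comb m σ = inMatching-cong m (coords-comb T σ)

  matching-corner : ∀ m i → matching m (c i) ≡ inMatching m (δ i)
  matching-corner m i = trans (cong (matching m) (sym (comb-δ i c))) (matching-comb m (δ i))

  matching-mid : ∀ m i j → matching m (c i ⊕ c j) ≡ inMatching m (δ i ⊻ δ j)
  matching-mid m i j = trans (cong (matching m) (corner-⊕ T i j)) (matching-comb m (δ i ⊻ δ j))

  line-one-matched : ∀ m (u : Fin 3 → V4) → IsLineOf T (u 0F) (u 1F) (u 2F) → UniqueAt (matching m ∘ u)
  line-one-matched m = line-unique (matching m) λ i j i≢j →
    trans (cong₂ (λ a b → trues (a ∷ b)) (matching-corner m i)
                 (cong₂ _∷_ (matching-corner m j) (cong (_∷ []) (matching-mid m i j))))
          (inMatching-line m i j i≢j)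

  point-matched : ∀ {x} → PointOf T x → ∃[ m ] matching m x ≡ true
  point-matched (inj₁ (i , refl)) = i , trans (matching-corner i i) (inMatching-corner i)
  point-matched (inj₂ (i , j , i≢j , refl)) =
    let m , mid = inMatching-mid i j i≢j in m , trans (matching-mid m i j) mid

TFlow : Tetrahedron → (G : CubicGraph) → (Dart (n G) → V4) → Set
TFlow T G φ = (∀ d → φ (ι G d) ≡ φ d) × (∀ d → PointOf T (φ d)) ×
              (∀ v → IsLineOf T (φ (v , 0F)) (φ (v , 1F)) (φ (v , 2F)))

TFlow⇒¬PMIndexAtLeast5 : ∀ T G {φ} → TFlow T G φ → ¬ PMIndexAtLeast5 G
TFlow⇒¬PMIndexAtLeast5 T G {φ} (on-edges , points , lines) π≥5 =
  π≥5 (tabulate M , ≤-refl , All.tabulate⁺ isPerfect , covered)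
  where
  M : Fin 4 → Dart (n G) → Bool
  M m = matching T m ∘ φ
  isPerfect : ∀ m → IsPerfectMatching G (M m)
  isPerfect m = (λ d → cong (matching T m) (on-edges d)) ,
                λ v → line-one-matched T m (λ j → φ (v , j)) (lines v)
  covered : ∀ d → Any (λ N → N d ≡ true) (tabulate M)
  covered d = let m , in-m = point-matched T (points d) in Any.tabulate⁺ {P = λ N → N d ≡ true} {f = M} m in-m

prev5 : Fin 5 → Fin 5
prev5 0F = 4F
prev5 1F = 0F
prev5 2F = 1F
prev5 3F = 2F
prev5 4F = 3F

next5-prev5 : ∀ k → next5 (prev5 k) ≡ k
next5-prev5 0F = refl
next5-prev5 1F = refl
next5-prev5 2F = refl
next5-prev5 3F = refl
next5-prev5 4F = refl

Adjacent5 : Fin 5 → Fin 5 → Set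
Adjacent5 i j = j ≡ next5 i ⊎ i ≡ next5 j

Path5 : Fin 5 → Fin 5 → Fin 5 → Set
Path5 i₀ i₁ i₂ = Adjacent5 i₀ i₁ × Adjacent5 i₁ i₂ × i₀ ≢ i₂

SideOff : Fin 5 → Fin 5 → Fin 5 → Fin 5 → Set
SideOff i₀ i₁ i₂ k = Avoids k × Avoids (next5 k)
  where
  Avoids : Fin 5 → Set
  Avoids l = l ≢ i₀ × l ≢ i₁ × l ≢ i₂

path5? : ∀ i₀ i₁ i₂ → Dec (Path5 i₀ i₁ i₂)
path5? i₀ i₁ i₂ = adjacent? i₀ i₁ ×-dec adjacent? i₁ i₂ ×-dec ¬? (i₀ ≟ᶠ i₂)
  where
  adjacent? : ∀ i j → Dec (Adjacent5 i j)
  adjacent? i j = j ≟ᶠ next5 i ⊎-dec i ≟ᶠ next5 j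

sideOff? : ∀ i₀ i₁ i₂ k → Dec (SideOff i₀ i₁ i₂ k)
sideOff? i₀ i₁ i₂ k = avoids? k ×-dec avoids? (next5 k)
  where
  avoids? : ∀ l → Dec (l ≢ i₀ × l ≢ i₁ × l ≢ i₂)
  avoids? l = ¬? (l ≟ᶠ i₀) ×-dec ¬? (l ≟ᶠ i₁) ×-dec ¬? (l ≟ᶠ i₂)

-- In a pentagon, the only side avoiding a path i₀ i₁ i₂ is the one opposite i₁, flanked by
-- i₀ and i₂.  Abstract, so that uses do not unfold the decision procedure.
abstract
  opposite-side : ∀ {i₀ i₁ i₂ k} → Path5 i₀ i₁ i₂ → SideOff i₀ i₁ i₂ k →
    (prev5 k ≡ i₀ × next5 (next5 k) ≡ i₂) ⊎ (prev5 k ≡ i₂ × next5 (next5 k) ≡ i₀)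
  opposite-side {i₀} {i₁} {i₂} {k} =
    toWitness {a? = all? λ i₀ → all? λ i₁ → all? λ i₂ → all? λ k →
      path5? i₀ i₁ i₂ →-dec sideOff? i₀ i₁ i₂ k →-dec
        ((prev5 k ≟ᶠ i₀ ×-dec next5 (next5 k) ≟ᶠ i₂) ⊎-dec
         (prev5 k ≟ᶠ i₂ ×-dec next5 (next5 k) ≟ᶠ i₀))} tt i₀ i₁ i₂ k

  opposite-side-unique : ∀ {i₀ i₁ i₂ k k′} → Path5 i₀ i₁ i₂ →
    SideOff i₀ i₁ i₂ k → SideOff i₀ i₁ i₂ k′ → k ≡ k′
  opposite-side-unique {i₀} {i₁} {i₂} {k} {k′} =
    toWitness {a? = all? λ i₀ → all? λ i₁ → all? λ i₂ → all? λ k → all? λ k′ →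
      path5? i₀ i₁ i₂ →-dec sideOff? i₀ i₁ i₂ k →-dec sideOff? i₀ i₁ i₂ k′ →-dec k ≟ᶠ k′} tt i₀ i₁ i₂ k k′

Endpoint : (G : CubicGraph) → Dart (n G) → Fin (n G) → Set
Endpoint G x v = v ≡ vx x ⊎ v ≡ vx (ι G x)

Reaches : (G : CubicGraph) → Dart (n G) → Fin (n G) → Set
Reaches G x p = Σ (Dart (n G)) λ u → Endpoint G x (vx u) × vx (ι G u) ≡ p

DisjointEnds : (G : CubicGraph) → Dart (n G) → Dart (n G) → Set
DisjointEnds G x y = ∀ v → Endpoint G x v → Endpoint G y v → ⊥

module _ {G : CubicGraph} (C : FiveCycle G) where

  side-vertices : ∀ {d k} → (d ≡ a C k ⊎ d ≡ ι G (a C k)) →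
    (vx d ≡ w C k × vx (ι G d) ≡ w C (next5 k)) ⊎ (vx d ≡ w C (next5 k) × vx (ι G d) ≡ w C k)
  side-vertices {k = k} (inj₁ refl) = inj₁ (a-src C k , a-tgt C k)
  side-vertices {k = k} (inj₂ refl) = inj₂ (a-tgt C k , trans (cong vx (ι-invol G (a C k))) (a-src C k))

  side-ends : ∀ {d k} → (d ≡ a C k ⊎ d ≡ ι G (a C k)) → Endpoint G d (w C k) × Endpoint G d (w C (next5 k))
  side-ends side with side-vertices side
  ... | inj₁ (s , t) = inj₁ (sym s) , inj₂ (sym t)
  ... | inj₂ (s , t) = inj₂ (sym t) , inj₁ (sym s)

  ∈E⇒∈V : ∀ {d} → d ∈E C → vx d ∈V C × vx (ι G d) ∈V C
  ∈E⇒∈V (k , side) with side-vertices side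
  ... | inj₁ (s , t) = (k , s) , (next5 k , t)
  ... | inj₂ (s , t) = (next5 k , s) , (k , t)

  endpoint-∈V : ∀ {d v} → d ∈E C → Endpoint G d v → v ∈V C
  endpoint-∈V d∈C (inj₁ refl) = proj₁ (∈E⇒∈V d∈C)
  endpoint-∈V d∈C (inj₂ refl) = proj₂ (∈E⇒∈V d∈C)

  ∈E⇒adjacent : ∀ {d i j} → d ∈E C → vx d ≡ w C i → vx (ι G d) ≡ w C j → Adjacent5 i j
  ∈E⇒adjacent {i = i} {j} (k , side) di dj with side-vertices side
  ... | inj₁ (s , t) = inj₁ (trans (w-inj C j _ (trans (sym dj) t)) (cong next5 (w-inj C k i (trans (sym s) di))))
  ... | inj₂ (s , t) = inj₂ (trans (w-inj C i _ (trans (sym di) s)) (cong next5 (w-inj C k j (trans (sym t) dj))))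

  reach-before : ∀ {d k} → (d ≡ a C k ⊎ d ≡ ι G (a C k)) → Reaches G d (w C (prev5 k))
  reach-before {k = k} side =
    ι G (a C (prev5 k)) ,
    subst (Endpoint G _) (sym (trans (a-tgt C (prev5 k)) (cong (w C) (next5-prev5 k)))) (proj₁ (side-ends side)) ,
    trans (cong vx (ι-invol G (a C (prev5 k)))) (a-src C (prev5 k))

  reach-after : ∀ {d k} → (d ≡ a C k ⊎ d ≡ ι G (a C k)) → Reaches G d (w C (next5 (next5 k)))
  reach-after {k = k} side =
    a C (next5 k) , subst (Endpoint G _) (sym (a-src C (next5 k))) (proj₂ (side-ends side)) , a-tgt C (next5 k)

OnPath : ∀ {m} → Fin m → Fin m → Fin m → Fin m → Set
OnPath p₀ p₁ p₂ v = v ≡ p₀ ⊎ v ≡ p₁ ⊎ v ≡ p₂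

module PathInCycle {G : CubicGraph} (C : FiveCycle G) {p₀ p₁ p₂ : Fin (n G)} {q₁ q₂ : Dart (n G)}
  (p₀∈C : p₀ ∈V C) (p₁∈C : p₁ ∈V C) (p₂∈C : p₂ ∈V C) (q₁∈C : q₁ ∈E C) (q₂∈C : q₂ ∈E C)
  (q₁-src : vx q₁ ≡ p₀) (q₁-tgt : vx (ι G q₁) ≡ p₁) (q₂-src : vx q₂ ≡ p₁) (q₂-tgt : vx (ι G q₂) ≡ p₂)
  (p₀≢p₂ : p₀ ≢ p₂) where

  private
    i₀ = proj₁ p₀∈C
    i₁ = proj₁ p₁∈C
    i₂ = proj₁ p₂∈C
    Off : Fin (n G) → Set
    Off v = ¬ OnPath p₀ p₁ p₂ v

    toward : ∀ {d l i p} → l ≡ i → p ≡ w C i → Reaches G d (w C l) → Reaches G d p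
    toward refl refl r = r

  path : Path5 i₀ i₁ i₂
  path = ∈E⇒adjacent C q₁∈C (trans q₁-src (proj₂ p₀∈C)) (trans q₁-tgt (proj₂ p₁∈C)) ,
         ∈E⇒adjacent C q₂∈C (trans q₂-src (proj₂ p₁∈C)) (trans q₂-tgt (proj₂ p₂∈C)) ,
         λ i₀≡i₂ → p₀≢p₂ (trans (proj₂ p₀∈C) (trans (cong (w C) i₀≡i₂) (sym (proj₂ p₂∈C))))

  side-off : ∀ {d k} → (d ≡ a C k ⊎ d ≡ ι G (a C k)) → Off (vx d) → Off (vx (ι G d)) → SideOff i₀ i₁ i₂ k
  side-off {d} side d-off ιd-off = avoids (proj₁ (side-ends C side)) , avoids (proj₂ (side-ends C side))
    where
    avoids : ∀ {l} → Endpoint G d (w C l) → l ≢ i₀ × l ≢ i₁ × l ≢ i₂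
    avoids end = (λ l≡i₀ → off end (inj₁ (trans (cong (w C) l≡i₀) (sym (proj₂ p₀∈C))))) ,
                 (λ l≡i₁ → off end (inj₂ (inj₁ (trans (cong (w C) l≡i₁) (sym (proj₂ p₁∈C)))))) ,
                 (λ l≡i₂ → off end (inj₂ (inj₂ (trans (cong (w C) l≡i₂) (sym (proj₂ p₂∈C))))))
      where
      off : ∀ {v} → Endpoint G d v → Off v
      off (inj₁ refl) = d-off
      off (inj₂ refl) = ιd-off

  outer-unique : ∀ {d d′} → d ∈E C → Off (vx d) → Off (vx (ι G d)) →
                 d′ ∈E C → Off (vx d′) → Off (vx (ι G d′)) → d′ ≡ d ⊎ d′ ≡ ι G d
  outer-unique (k , side) d-off ιd-off (k′ , side′) d′-off ιd′-off
    with opposite-side-unique path (side-off side d-off ιd-off) (side-off side′ d′-off ιd′-off)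
  outer-unique (k , inj₁ refl) _ _ (k , inj₁ refl) _ _ | refl = inj₁ refl
  outer-unique (k , inj₁ refl) _ _ (k , inj₂ refl) _ _ | refl = inj₂ refl
  outer-unique (k , inj₂ refl) _ _ (k , inj₁ refl) _ _ | refl = inj₂ (sym (ι-invol G (a C k)))
  outer-unique (k , inj₂ refl) _ _ (k , inj₂ refl) _ _ | refl = inj₁ refl

  outer-reaches : ∀ {d} → d ∈E C → Off (vx d) → Off (vx (ι G d)) → Reaches G d p₀ × Reaches G d p₂
  outer-reaches {d} (k , side) d-off ιd-off with opposite-side path (side-off side d-off ιd-off)
  ... | inj₁ (before , after) =
    toward {d} before (proj₂ p₀∈C) (reach-before C side) , toward {d} after (proj₂ p₂∈C) (reach-after C side)
  ... | inj₂ (before , after) =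
    toward {d} after (proj₂ p₀∈C) (reach-after C side) , toward {d} before (proj₂ p₂∈C) (reach-before C side)

abstract
  fin3-remaining : ∀ (i j₁ j₂ j₃ : Fin 3) → j₁ ≢ j₂ → j₁ ≢ j₃ → j₂ ≢ j₃ → i ≢ j₁ → i ≢ j₂ → i ≡ j₃
  fin3-remaining = toWitness {a? = all? λ i → all? λ j₁ → all? λ j₂ → all? λ j₃ →
    ¬? (j₁ ≟ᶠ j₂) →-dec ¬? (j₁ ≟ᶠ j₃) →-dec ¬? (j₂ ≟ᶠ j₃) →-dec ¬? (i ≟ᶠ j₁) →-dec ¬? (i ≟ᶠ j₂) →-dec i ≟ᶠ j₃} tt

module Marking {G : CubicGraph} (M : Dart (n G) → Bool) (one-per-vertex : ∀ v → UniqueAt (λ j → M (v , j))) where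

  private
    D = Dart (n G)

  marked-unique : ∀ {d d′ : D} → vx d ≡ vx d′ → M d ≡ true → M d′ ≡ true → d ≡ d′
  marked-unique {v , j} {.v , j′} refl Md Md′ =
    let _ , _ , only = one-per-vertex v in cong (v ,_) (trans (only j Md) (sym (only j′ Md′)))

  marked-third : ∀ {d₁ d₂ d₃ : D} → vx d₁ ≡ vx d₃ → vx d₂ ≡ vx d₃ → d₁ ≢ d₂ → d₁ ≢ d₃ → d₂ ≢ d₃ →
                 M d₁ ≡ false → M d₂ ≡ false → M d₃ ≡ true
  marked-third {v , j₁} {.v , j₂} {.v , j₃} refl refl d₁≢d₂ d₁≢d₃ d₂≢d₃ M₁ M₂ =
    subst (λ j → M (v , j) ≡ true) i≡j₃ Mi
    where
    i = proj₁ (one-per-vertex v)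
    Mi = proj₁ (proj₂ (one-per-vertex v))
    unmarked : ∀ {j} → M (v , j) ≡ false → i ≢ j
    unmarked Mj refl with () ← trans (sym Mi) Mj
    i≡j₃ : i ≡ j₃
    i≡j₃ = fin3-remaining i j₁ j₂ j₃ (d₁≢d₂ ∘ cong (v ,_)) (d₁≢d₃ ∘ cong (v ,_)) (d₂≢d₃ ∘ cong (v ,_))
             (unmarked M₁) (unmarked M₂)

  module Path {p₀ p₁ p₂ : Fin (n G)} {q₁ q₂ : D}
    (q₁-src : vx q₁ ≡ p₀) (q₁-tgt : vx (ι G q₁) ≡ p₁) (q₂-src : vx q₂ ≡ p₁) (q₂-tgt : vx (ι G q₂) ≡ p₂)
    (p₀≢p₂ : p₀ ≢ p₂) (path-internal : ∀ d → OnPath p₀ p₁ p₂ (vx d) → M (ι G d) ≡ M d) where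

    private
      Off : Fin (n G) → Set
      Off v = ¬ OnPath p₀ p₁ p₂ v

    MarkedOff : D → Set
    MarkedOff x = M x ≡ true × M (ι G x) ≡ true × Off (vx x) × Off (vx (ι G x))

    endpoint-off : ∀ {x v} → MarkedOff x → Endpoint G x v → Off v
    endpoint-off (_ , _ , off , _) (inj₁ refl) = off
    endpoint-off (_ , _ , _ , off) (inj₂ refl) = off

    marked-across : ∀ {d} → OnPath p₀ p₁ p₂ (vx (ι G d)) → M d ≡ M (ι G d)
    marked-across {d} on = trans (cong M (sym (ι-invol G d))) (path-internal (ι G d) on)

    unmarked-toward : ∀ {x p} → MarkedOff x → OnPath p₀ p₁ p₂ p → ((u , _ , _) : Reaches G x p) → M (ι G u) ≡ false
    unmarked-toward {x} {p} (Mx , Mιx , x-off , ιx-off) p-on (u , end , u→p) =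
      trans (sym (marked-across (subst (OnPath p₀ p₁ p₂) (sym u→p) p-on))) (¬-not (unmarked end))
      where
      unmarked : Endpoint G x (vx u) → M u ≢ true
      unmarked (inj₁ u∼x) Mu = ιx-off (subst (OnPath p₀ p₁ p₂) (sym ιx→p) p-on)
        where
        ιx→p : vx (ι G x) ≡ p
        ιx→p = trans (cong (vx ∘ ι G) (sym (marked-unique u∼x Mu Mx))) u→p
      unmarked (inj₂ u∼ιx) Mu = x-off (subst (OnPath p₀ p₁ p₂) (sym x→p) p-on)
        where
        x→p : vx x ≡ p
        x→p = trans (cong vx (sym (ι-invol G x))) (trans (cong (vx ∘ ι G) (sym (marked-unique u∼ιx Mu Mιx))) u→p)

    marked-hub : ∀ {e f p q} → MarkedOff e → MarkedOff f → DisjointEnds G e f →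
      OnPath p₀ p₁ p₂ p → vx q ≡ p → OnPath p₀ p₁ p₂ (vx (ι G q)) → Reaches G e p → Reaches G f p → M q ≡ true
    marked-hub {e} {f} {p} {q} me mf disjoint p-on q-at q-on re@(uₑ , endₑ , uₑ→p) rf@(u_f , end_f , u_f→p) =
      marked-third (trans uₑ→p (sym q-at)) (trans u_f→p (sym q-at)) ends-differ
        (not-toward-q me endₑ) (not-toward-q mf end_f) (unmarked-toward me p-on re) (unmarked-toward mf p-on rf)
      where
      ends-differ : ι G uₑ ≢ ι G u_f
      ends-differ eq = disjoint (vx uₑ) endₑ (subst (λ y → Endpoint G f (vx y)) (sym (ι-injective G eq)) end_f)
      not-toward-q : ∀ {x u} → MarkedOff x → Endpoint G x (vx u) → ι G u ≢ q
      not-toward-q {u = u} mx end eq =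
        endpoint-off mx end (subst (OnPath p₀ p₁ p₂) (trans (cong (vx ∘ ι G) (sym eq)) (cong vx (ι-invol G u))) q-on)

    no-marked-pair : ∀ {e f} → MarkedOff e → MarkedOff f → DisjointEnds G e f →
      Reaches G e p₀ × Reaches G e p₂ → Reaches G f p₀ × Reaches G f p₂ → ⊥
    no-marked-pair me mf disjoint (e₀ , e₂) (f₀ , f₂) = p₀≢p₂ (begin
      p₀                  ≡⟨ q₁-src ⟨
      vx q₁               ≡⟨ cong vx (ι-invol G q₁) ⟨
      vx (ι G (ι G q₁))   ≡⟨ cong (vx ∘ ι G) ιq₁≡q₂ ⟩
      vx (ι G q₂)         ≡⟨ q₂-tgt ⟩
      p₂                  ∎)
      where
      open ≡-Reasoning
      p₁-on : OnPath p₀ p₁ p₂ p₁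
      p₁-on = inj₂ (inj₁ refl)
      Mq₁ : M q₁ ≡ true
      Mq₁ = marked-hub me mf disjoint (inj₁ refl) q₁-src (subst (OnPath p₀ p₁ p₂) (sym q₁-tgt) p₁-on) e₀ f₀
      Mιq₂ : M (ι G q₂) ≡ true
      Mιq₂ = marked-hub me mf disjoint (inj₂ (inj₂ refl)) q₂-tgt
               (subst (OnPath p₀ p₁ p₂) (sym (trans (cong vx (ι-invol G q₂)) q₂-src)) p₁-on) e₂ f₂
      ιq₁≡q₂ : ι G q₁ ≡ q₂
      ιq₁≡q₂ = marked-unique (trans q₁-tgt (sym q₂-src))
        (trans (sym (marked-across (subst (OnPath p₀ p₁ p₂) (sym q₁-tgt) p₁-on))) Mq₁)
        (trans (marked-across (inj₂ (inj₂ q₂-tgt))) Mιq₂)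

sever-other : ∀ {m} (ι : Dart m → Dart m) {x d} → d ≢ x → d ≢ ι x → sever ι x d ≡ ι d
sever-other ι {x} {d} d≢x d≢ιx with d ≟ᵈ x | d ≟ᵈ ι x
... | yes d≡x | _         = ⊥-elim (d≢x d≡x)
... | no _    | yes d≡ιx = ⊥-elim (d≢ιx d≡ιx)
... | no _    | no _     = refl

severTwo-invariantOff : ∀ G {e f} {φ : Dart (n G) → V4} → DifferentEdges G e f →
  (∀ d → φ (κ (severTwo G e f) d) ≡ φ d) → InvariantOff G (e ∷ ι G e ∷ f ∷ ι G f ∷ []) φ
severTwo-invariantOff G {e} {f} {φ} (f≢e , f≢ιe) on-edges d d∉ = trans (cong φ (sym κd≡ιd)) (on-edges d)
  where
  κd≡ιd : sever (sever (ι G) e) f d ≡ ι G d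
  κd≡ιd = trans (sever-other (sever (ι G) e) (d∉ ∘ there ∘ there ∘ here)
                   (λ d≡ → d∉ (there (there (there (here (trans d≡ (sever-other (ι G) f≢e f≢ιe))))))))
                (sever-other (ι G) (d∉ ∘ here) (d∉ ∘ there ∘ here))

MidShape : Shape → Set
MidShape s = s ≡ ang ⊎ s ≡ ax

shape-mids : ∀ T {s x y} → MidShape s → HasShape T s x y → isMid T x ≡ true × isMid T y ≡ true
shape-mids T (inj₁ refl) (i , j , k , (i≢j , i≢k , _) , inj₁ (refl , refl)) = isMid-mid T i≢j , isMid-mid T i≢k
shape-mids T (inj₁ refl) (i , j , k , (i≢j , i≢k , _) , inj₂ (refl , refl)) = isMid-mid T i≢k , isMid-mid T i≢j
shape-mids T (inj₂ refl) (i , j , k , l , (i≢j , _ , _ , _ , _ , k≢l) , inj₁ (refl , refl)) =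
  isMid-mid T i≢j , isMid-mid T k≢l
shape-mids T (inj₂ refl) (i , j , k , l , (i≢j , _ , _ , _ , _ , k≢l) , inj₂ (refl , refl)) =
  isMid-mid T k≢l , isMid-mid T i≢j

allowed-by-rank : ∀ s t → shapeRank s ≡ shapeRank t → ¬ (s ≡ dpt × t ≡ dpt) → ¬ (MidShape s × MidShape t) →
                  AllowedTransition s t
allowed-by-rank hl  hl  _ _ _ = inj₁ (refl , refl)
allowed-by-rank ls  ls  _ _ _ = inj₂ (inj₁ (refl , refl))
allowed-by-rank alt alt _ _ _ = inj₂ (inj₂ (inj₁ (refl , refl)))
allowed-by-rank ang ls  _ _ _ = inj₂ (inj₂ (inj₂ (inj₁ (refl , refl))))
allowed-by-rank ls  ang _ _ _ = inj₂ (inj₂ (inj₂ (inj₂ (refl , refl))))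
allowed-by-rank ang ang _ _ ¬mids = ⊥-elim (¬mids (inj₁ refl , inj₁ refl))
allowed-by-rank ax  ax  _ _ ¬mids = ⊥-elim (¬mids (inj₂ refl , inj₂ refl))
allowed-by-rank dpt dpt _ ¬dpts _ = ⊥-elim (¬dpts (refl , refl))
allowed-by-rank ls  hl  () _ _
allowed-by-rank ls  alt () _ _
allowed-by-rank ls  ax  () _ _
allowed-by-rank ls  dpt () _ _
allowed-by-rank hl  ls  () _ _
allowed-by-rank hl  ang () _ _
allowed-by-rank hl  alt () _ _
allowed-by-rank hl  ax  () _ _
allowed-by-rank hl  dpt () _ _
allowed-by-rank ang hl  () _ _
allowed-by-rank ang alt () _ _
allowed-by-rank ang ax  () _ _
allowed-by-rank ang dpt () _ _
allowed-by-rank alt ls  () _ _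
allowed-by-rank alt hl  () _ _
allowed-by-rank alt ang () _ _
allowed-by-rank alt ax  () _ _
allowed-by-rank alt dpt () _ _
allowed-by-rank ax  ls  () _ _
allowed-by-rank ax  hl  () _ _
allowed-by-rank ax  ang () _ _
allowed-by-rank ax  alt () _ _
allowed-by-rank ax  dpt () _ _
allowed-by-rank dpt ls  () _ _
allowed-by-rank dpt hl  () _ _
allowed-by-rank dpt ang () _ _
allowed-by-rank dpt alt () _ _
allowed-by-rank dpt ax  () _ _

outer-edges-unmarked : ∀ G {C₁ C₂} → IntersectionIsPath2 G C₁ C₂ → ∀ {e f} →
  OuterEdge G C₁ C₂ e → OuterEdge G C₁ C₂ f → DifferentEdges G e f →
  (M : Dart (n G) → Bool) → (∀ v → UniqueAt (λ j → M (v , j))) →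
  (∀ d → d ∉ e ∷ ι G e ∷ f ∷ ι G f ∷ [] → M (ι G d) ≡ M d) →
  ¬ ((M e ≡ true × M (ι G e) ≡ true) × (M f ≡ true × M (ι G f) ≡ true))
outer-edges-unmarked G {C₁} {C₂}
  (p₀ , p₁ , p₂ , q₁ , q₂ , (_ , p₀≢p₂ , _) , (q₁-src , q₁-tgt , q₂-src , q₂-tgt) , vertices , edges)
  {e} {f} (e∈ , e-off , ιe-off) (f∈ , f-off , ιf-off) (f≢e , f≢ιe)
  M one-per-vertex unsevered ((Me , Mιe) , (Mf , Mιf))
  = cases e∈ f∈
  where
  OnPath′ = OnPath p₀ p₁ p₂
  on-both : ∀ {v} → OnPath′ v → v ∈V C₁ × v ∈V C₂
  on-both {v} = proj₂ (vertices v)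
  off : ∀ {v} → ¬ (v ∈V C₁ × v ∈V C₂) → ¬ OnPath′ v
  off ¬both = ¬both ∘ on-both
  q-both : ∀ {q} → (q ≡ q₁ ⊎ q ≡ ι G q₁ ⊎ q ≡ q₂ ⊎ q ≡ ι G q₂) → q ∈E C₁ × q ∈E C₂
  q-both {q} = proj₂ (edges q)

  module Path₁ = PathInCycle C₁ (proj₁ (on-both (inj₁ refl))) (proj₁ (on-both (inj₂ (inj₁ refl))))
    (proj₁ (on-both (inj₂ (inj₂ refl)))) (proj₁ (q-both (inj₁ refl))) (proj₁ (q-both (inj₂ (inj₂ (inj₁ refl)))))
    q₁-src q₁-tgt q₂-src q₂-tgt p₀≢p₂
  module Path₂ = PathInCycle C₂ (proj₂ (on-both (inj₁ refl))) (proj₂ (on-both (inj₂ (inj₁ refl))))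
    (proj₂ (on-both (inj₂ (inj₂ refl)))) (proj₂ (q-both (inj₁ refl))) (proj₂ (q-both (inj₂ (inj₂ (inj₁ refl)))))
    q₁-src q₁-tgt q₂-src q₂-tgt p₀≢p₂

  path-internal : ∀ d → OnPath′ (vx d) → M (ι G d) ≡ M d
  path-internal d on = unsevered d λ
    { (here d≡e) → off e-off (subst OnPath′ (cong vx d≡e) on)
    ; (there (here d≡ιe)) → off ιe-off (subst OnPath′ (cong vx d≡ιe) on)
    ; (there (there (here d≡f))) → off f-off (subst OnPath′ (cong vx d≡f) on)
    ; (there (there (there (here d≡ιf)))) → off ιf-off (subst OnPath′ (cong vx d≡ιf) on) }

  open Marking {G} M one-per-vertex
  open Marking.Path {G} M one-per-vertex q₁-src q₁-tgt q₂-src q₂-tgt p₀≢p₂ path-internal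

  marked-e : MarkedOff e
  marked-e = Me , Mιe , off e-off , off ιe-off
  marked-f : MarkedOff f
  marked-f = Mf , Mιf , off f-off , off ιf-off

  disjoint : ∀ {Cₑ C_f : FiveCycle G} → e ∈E Cₑ → f ∈E C_f →
    (∀ {v} → v ∈V Cₑ → v ∈V C_f → v ∈V C₁ × v ∈V C₂) → DisjointEnds G e f
  disjoint {Cₑ} {C_f} e∈Cₑ f∈C_f both v e-end f-end = endpoint-off marked-e e-end
    (proj₁ (vertices v) (both (endpoint-∈V Cₑ e∈Cₑ e-end) (endpoint-∈V C_f f∈C_f f-end)))

  same-edge : f ≡ e ⊎ f ≡ ι G e → ⊥
  same-edge (inj₁ f≡e)  = f≢e f≡e
  same-edge (inj₂ f≡ιe) = f≢ιe f≡ιe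

  cases : e ∈E C₁ ⊎ e ∈E C₂ → f ∈E C₁ ⊎ f ∈E C₂ → ⊥
  cases (inj₁ e∈C₁) (inj₁ f∈C₁) =
    same-edge (Path₁.outer-unique e∈C₁ (off e-off) (off ιe-off) f∈C₁ (off f-off) (off ιf-off))
  cases (inj₂ e∈C₂) (inj₂ f∈C₂) =
    same-edge (Path₂.outer-unique e∈C₂ (off e-off) (off ιe-off) f∈C₂ (off f-off) (off ιf-off))
  cases (inj₁ e∈C₁) (inj₂ f∈C₂) =
    no-marked-pair {e} {f} marked-e marked-f (disjoint {C₁} {C₂} e∈C₁ f∈C₂ _,_)
      (Path₁.outer-reaches e∈C₁ (off e-off) (off ιe-off)) (Path₂.outer-reaches f∈C₂ (off f-off) (off ιf-off))
  cases (inj₂ e∈C₂) (inj₁ f∈C₁) =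
    no-marked-pair {e} {f} marked-e marked-f (disjoint {C₂} {C₁} e∈C₂ f∈C₁ (λ v∈C₂ v∈C₁ → v∈C₁ , v∈C₂))
      (Path₂.outer-reaches e∈C₂ (off e-off) (off ιe-off)) (Path₁.outer-reaches f∈C₁ (off f-off) (off ιf-off))

proposition4p1 : (T : Tetrahedron) (G : CubicGraph) → PMIndexAtLeast5 G →
    (C₁ C₂ : FiveCycle G) → IntersectionIsPath2 G C₁ C₂ →
    (e f : Dart (n G)) → OuterEdge G C₁ C₂ e → OuterEdge G C₁ C₂ f →
    DifferentEdges G e f →
    (s t : Shape) → Transition T (severTwo G e f) s t → AllowedTransition s t
proposition4p1 T G π≥5 C₁ C₂ path e f outer-e outer-f e≠f s t
  (φ , (on-edges , points , lines) , s-shape , t-shape) =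
  allowed-by-rank s t same-rank not-both-dpt not-both-mid
  where
  unsevered : InvariantOff G (e ∷ ι G e ∷ f ∷ ι G f ∷ []) φ
  unsevered = severTwo-invariantOff G e≠f on-edges

  same-rank : shapeRank s ≡ shapeRank t
  same-rank = begin
    shapeRank s              ≡⟨ shape-rank T s s-shape ⟨
    rank T (φ e ⊕ φ (ι G e)) ≡⟨ cong (rank T) (conservation G φ e≠f unsevered (Σᵈ-lines T φ lines)) ⟩
    rank T (φ f ⊕ φ (ι G f)) ≡⟨ shape-rank T t t-shape ⟩
    shapeRank t              ∎
    where open ≡-Reasoning

  not-both-dpt : ¬ (s ≡ dpt × t ≡ dpt)
  not-both-dpt (refl , refl) = TFlow⇒¬PMIndexAtLeast5 T G (glued , points , lines) π≥5
    where
    glued : ∀ d → φ (ι G d) ≡ φ d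
    glued d = seal G f [] φ (seal G e _ φ unsevered (sym (proj₂ s-shape))) (sym (proj₂ t-shape)) d (λ ())

  not-both-mid : ¬ (MidShape s × MidShape t)
  not-both-mid (s-mid , t-mid) =
    outer-edges-unmarked G {C₁} {C₂} path outer-e outer-f e≠f (isMid T ∘ φ)
      (λ v → line-one-mid T (λ j → φ (v , j)) (lines v)) (λ d d∉ → cong (isMid T) (unsevered d d∉))
      (shape-mids T s-mid s-shape , shape-mids T t-mid t-shape)
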